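{- Let $G$ be a minimal counterexample as described in the context, with a fixed plane embedding. Let $v$ be a vertex of degree $8$. If $v$ has a neighbour $w$ of degree $3$ such that the edge $vw$ lies on two $3$-faces, then $v$ has no neighbour of degree $2$.
   Context: A total $9$-coloring of a graph assigns to every vertex and every edge one of $9$ colors so that adjacent vertices, edges sharing an endpoint, and a vertex and an edge incident to it all receive different colors. A $4$-fan is a path $x_1x_2x_3x_4x_5$ together with one further vertex adjacent to all of $x_1,\dots,x_5$. A minimal counterexample is a simple planar graph $G$ of maximum degree $8$ containing no subgraph isomorphic to a $4$-fan, having no total $9$-coloring, with $|V(G)|+|E(G)|$ minimum among all such graphs; as part of this standing assumption, for every $x\in V(G)\cup E(G)$ the graph $G-x$ admits a total $9$-coloring. Faces refer to the fixed plane embedding; a $3$-face is a face whose boundary has length $3$. -}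

module Defs where

open import Data.Nat using (ℕ; zero; suc; _+_; _*_; _≤_; _<_)
open import Data.Nat.Base using (_<ᵇ_; _≤ᵇ_)
open import Data.Bool using (Bool; true; false; _∧_; _∨_; not; if_then_else_; T)
open import Data.Bool.Properties using (∧-comm; ∨-comm)
open import Data.Fin using (Fin; zero; suc; toℕ; punchIn; inject₁; _≟_)
open import Data.Product using (Σ; _×_; _,_; ∃; ∃-syntax; proj₁; proj₂)
open import Data.Empty using (⊥)
open import Function using (_∘_)
open import Function.Definitions using (Injective)
open import Relation.Nullary using (¬_; does)
open import Relation.Binary.PropositionalEquality using (_≡_; _≢_; refl; cong₂; sym; trans)

record Graph (n : ℕ) : Set where
  field
    adj     : Fin n → Fin n → Bool
    adj-sym : ∀ u v → adj u v ≡ adj v u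
    adj-irr : ∀ u → adj u u ≡ false
open Graph public

Adj : ∀ {n} → Graph n → Fin n → Fin n → Set
Adj G u v = T (adj G u v)

count : ∀ {n} → (Fin n → Bool) → ℕ
count {zero}  p = 0
count {suc n} p = (if p zero then 1 else 0) + count (p ∘ suc)

sumFin : ∀ {n} → (Fin n → ℕ) → ℕ
sumFin {zero}  f = 0
sumFin {suc n} f = f zero + sumFin (f ∘ suc)

anyᵇ : ∀ {n} → (Fin n → Bool) → Bool
anyᵇ {zero}  p = false
anyᵇ {suc n} p = p zero ∨ anyᵇ (p ∘ suc)

allᵇ : ∀ {n} → (Fin n → Bool) → Bool
allᵇ {zero}  p = true
allᵇ {suc n} p = p zero ∧ allᵇ (p ∘ suc)

allBelow : ℕ → (ℕ → Bool) → Bool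
allBelow zero    p = true
allBelow (suc N) p = allBelow N p ∧ p N

_==_ : ∀ {n} → Fin n → Fin n → Bool
a == b = does (a ≟ b)

deg : ∀ {n} → Graph n → Fin n → ℕ
deg G v = count (adj G v)

edgeCount : ∀ {n} → Graph n → ℕ
edgeCount G = sumFin (λ u → count (λ v → adj G u v ∧ (toℕ u <ᵇ toℕ v)))

MaxDegree : ∀ {n} → Graph n → ℕ → Set
MaxDegree G Δ = (∀ v → deg G v ≤ Δ) × (∃[ v ] deg G v ≡ Δ)

removeVertex : ∀ {m} → Graph (suc m) → Fin (suc m) → Graph m
removeVertex G x = record
  { adj     = λ i j → adj G (punchIn x i) (punchIn x j)
  ; adj-sym = λ i j → adj-sym G (punchIn x i) (punchIn x j)
  ; adj-irr = λ i → adj-irr G (punchIn x i) }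

isPair : ∀ {n} → Fin n → Fin n → Fin n → Fin n → Bool
isPair a b u v = ((u == a) ∧ (v == b)) ∨ ((u == b) ∧ (v == a))

private
  isPair-sym : ∀ {n} (a b u v : Fin n) → isPair a b u v ≡ isPair a b v u
  isPair-sym a b u v =
    trans (cong₂ _∨_ (∧-comm (u == a) (v == b)) (∧-comm (u == b) (v == a)))
          (∨-comm ((v == b) ∧ (u == a)) ((v == a) ∧ (u == b)))

  irr-lemma : ∀ (x : Bool) {y} → x ≡ false → x ∧ y ≡ false
  irr-lemma .false refl = refl

deleteEdge : ∀ {n} → Graph n → Fin n → Fin n → Graph n
deleteEdge G a b = record
  { adj     = λ u v → adj G u v ∧ not (isPair a b u v)
  ; adj-sym = λ u v → cong₂ (λ x y → x ∧ not y) (adj-sym G u v) (isPair-sym a b u v)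
  ; adj-irr = λ u → irr-lemma (adj G u u) (adj-irr G u) }

record TotalColoring (k : ℕ) {n} (G : Graph n) : Set where
  field
    vcol     : Fin n → Fin k
    ecol     : Fin n → Fin n → Fin k
    ecol-sym : ∀ u v → ecol u v ≡ ecol v u
    vv : ∀ u v → Adj G u v → vcol u ≢ vcol v
    ve : ∀ u v → Adj G u v → vcol u ≢ ecol u v
    ee : ∀ u v w → Adj G u v → Adj G u w → v ≢ w → ecol u v ≢ ecol u w

ColorableMinusVertex : ℕ → ∀ {n} → Graph n → Fin n → Set
ColorableMinusVertex k {suc m} G x = TotalColoring k (removeVertex G x)

-- 4-fans: a path x1..x5 plus a vertex c adjacent to all xi,
-- encoded by an injective f : Fin 6 → V with f 0 = c, f (1+i) = x_{i+1}.

HasFourFan : ∀ {n} → Graph n → Set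
HasFourFan {n} G =
  Σ (Fin 6 → Fin n) λ f →
    Injective _≡_ _≡_ f
    × (∀ (i : Fin 5) → Adj G (f zero) (f (suc i)))
    × (∀ (i : Fin 4) → Adj G (f (suc (inject₁ i))) (f (suc (suc i))))

iter : ∀ {A : Set} → (A → A) → ℕ → A → A
iter f zero    x = x
iter f (suc k) x = f (iter f k x)

record RotationSystem {n} (G : Graph n) : Set where
  field
    rot        : Fin n → Fin n → Fin n
    rot-adj    : ∀ u v → Adj G u v → Adj G u (rot u v)
    rot-cyclic : ∀ u v w → Adj G u v → Adj G u w → ∃[ k ] iter (rot u) k v ≡ w
open RotationSystem public

Dart : ℕ → Set
Dart n = Fin n × Fin n

-- face-tracing permutation on darts (u , v) with uv ∈ E
faceStep : ∀ {n} {G : Graph n} → RotationSystem G → Dart n → Dart n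
faceStep R (u , v) = (v , rot R v u)

private
  key : ∀ {n} → Dart n → ℕ
  key {n} (u , v) = toℕ u * n + toℕ v

  -- dart d is the key-minimal dart of its face (orbit under faceStep)
  faceRep : ∀ {n} {G : Graph n} → RotationSystem G → Dart n → Bool
  faceRep {n} R d = allBelow (n * n) (λ j → key d ≤ᵇ key (iter (faceStep R) j d))

dartFaces : ∀ {n} {G : Graph n} → RotationSystem G → ℕ
dartFaces {G = G} R = sumFin (λ u → count (λ v → adj G u v ∧ faceRep R (u , v)))

isolatedCount : ∀ {n} → Graph n → ℕ
isolatedCount G = count (λ v → not (anyᵇ (adj G v)))

-- number of faces (each isolated vertex contributes one face)
faceCount : ∀ {n} {G : Graph n} → RotationSystem G → ℕ
faceCount {G = G} R = dartFaces R + isolatedCount G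

reach : ∀ {n} → Graph n → ℕ → Fin n → Fin n → Bool
reach G zero    v x = v == x
reach G (suc k) v x = reach G k v x ∨ anyᵇ (λ y → reach G k v y ∧ adj G y x)

componentCount : ∀ {n} → Graph n → ℕ
componentCount {n} G =
  count (λ v → not (anyᵇ (λ u → reach G n v u ∧ (toℕ u <ᵇ toℕ v))))

-- the rotation system is a plane (genus 0) embedding: Euler's formula
-- V - E + F = 2C, written in ℕ as V + F = 2C + E
IsPlaneEmbedding : ∀ {n} (G : Graph n) → RotationSystem G → Set
IsPlaneEmbedding {n} G R = n + faceCount R ≡ 2 * componentCount G + edgeCount G

Planar : ∀ {n} → Graph n → Set
Planar G = Σ (RotationSystem G) (IsPlaneEmbedding G)

FaceLength : ∀ {n} {G : Graph n} → RotationSystem G → Dart n → ℕ → Set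
FaceLength R d k =
  1 ≤ k × iter (faceStep R) k d ≡ d
  × (∀ j → 1 ≤ j → j < k → iter (faceStep R) j d ≢ d)

OnTwo3Faces : ∀ {n} {G : Graph n} → RotationSystem G → Fin n → Fin n → Set
OnTwo3Faces R v w =
  FaceLength R (v , w) 3 × FaceLength R (w , v) 3
  × (∀ j → iter (faceStep R) j (v , w) ≢ (w , v))

record MinimalCounterexample {n} (G : Graph n) : Set₁ where
  field
    planar     : Planar G
    maxDeg     : MaxDegree G 8
    fanFree    : ¬ HasFourFan G
    noColoring : ¬ TotalColoring 9 G
    minimal    : ∀ m (H : Graph m) → Planar H → MaxDegree H 8 → ¬ HasFourFan H
                 → ¬ TotalColoring 9 H → n + edgeCount G ≤ m + edgeCount H
    delVertex  : ∀ x → ColorableMinusVertex 9 G x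
    delEdge    : ∀ a b → Adj G a b → TotalColoring 9 (deleteEdge G a b)

-- Minimality gives a total 9-colouring ψ of G − vu; uncolour u and w as well.  Having degree at most 4,
-- u and w see at most 8 colours each and can be recoloured last, so it suffices to colour vu, possibly
-- after recolouring a few edges near w.  As vu is uncoloured, some colour α is missing at the degree-8
-- vertex v.  Let x′ be the other neighbour of u, and X, Y the apexes of the two triangles on vw, which
-- are the other two neighbours of w.
--   * α not on ux′: colour vu with α.
--   * α on neither wX nor wY: recolour vw with α and give vu the old colour β of vw.
--   * α on wX and X = u: recolour uw with a colour not on vw, wX, wY, then colour vu with α.
--   * α on wX, X ≠ u, and γ the colour of vX: if γ is not on wY, swap the colours of vX and wX and colour
--     vu with γ; otherwise, with ε the colour of vY, shift the colours around the 4-cycle v X w Y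
--     (vX ↦ α, Xw ↦ γ, wY ↦ ε, Yv ↦ γ) and colour vu with ε.
-- Every case yields a total 9-colouring of G, which has none.

module Submission where

open import Defs
open import Data.Nat using (ℕ; zero; suc; _+_; _≤_; _<_; z≤n; s≤s)
open import Data.Nat.Properties
  using (≤-trans; ≤-reflexive; ≤-refl; <-irrefl; <-≤-trans; +-suc; +-mono-≤; m≤n⇒m≤1+n; module ≤-Reasoning)
open import Data.Bool using (Bool; true; false; if_then_else_)
open import Data.Unit using (tt)
open import Data.Fin using (Fin; zero; suc; _≟_)
open import Data.Fin.Properties using (¬∀⟶∃¬)
open import Data.Maybe using (Maybe; just; nothing; fromMaybe)
open import Data.Maybe.Properties using (just-injective; ≡-dec)
open import Data.Maybe.Relation.Unary.Any using () renaming (just to just-any)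
open import Data.List using (List; []; _∷_; _++_; length; map; filter; tabulate; allFin; catMaybes)
open import Data.List.Properties using (length-++; length-map; length-tabulate; length-catMaybes; Any-catMaybes⁺)
open import Data.List.Membership.Propositional using (_∈_; _∉_)
open import Data.List.Membership.Propositional.Properties
  using (∈-∃++; ∈-++⁻; ∈-++⁺ˡ; ∈-++⁺ʳ; ∈-map⁺; ∈-filter⁺; ∈-filter⁻; ∈-allFin)
open import Data.List.Membership.DecPropositional using () renaming (_∈?_ to member?)
open import Data.List.Relation.Unary.All as All using (All; []; _∷_)
open import Data.List.Relation.Unary.All.Properties using (¬Any⇒All¬)
open import Data.List.Relation.Unary.Any as Any using (Any; here; there; any?)
open import Data.List.Relation.Unary.Any.Properties using (++⁺ˡ; ++⁺ʳ)
open import Data.List.Relation.Unary.AllPairs using ([]; _∷_)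
open import Data.List.Relation.Unary.Unique.Propositional using (Unique)
open import Data.List.Relation.Unary.Unique.Propositional.Properties using (filter⁺; allFin⁺)
open import Data.List.Relation.Binary.Subset.Propositional using (_⊆_)
open import Data.Product as Product using (∃-syntax; _×_; _,_; proj₁; proj₂)
open import Data.Sum using (_⊎_; inj₁; inj₂; [_,_]′)
open import Function using (_∘_)
open import Relation.Nullary using (¬_; contradiction; yes; no; Dec; does)
open import Relation.Nullary.Decidable using (T?; _×-dec_; _⊎-dec_)
open import Relation.Binary.PropositionalEquality
  using (_≡_; _≢_; refl; sym; trans; cong; cong₂; subst; ≢-sym; module ≡-Reasoning)

unique-⊆⇒length-≤ : ∀ {A : Set} {xs ys : List A} → Unique xs → xs ⊆ ys → length xs ≤ length ys
unique-⊆⇒length-≤ [] _ = z≤n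
unique-⊆⇒length-≤ {xs = x ∷ xs} {ys} (x∉xs ∷ unique) x∷xs⊆ys
  with ys₁ , ys₂ , refl ← ∈-∃++ (x∷xs⊆ys (here refl)) =
  ≤-trans (s≤s (unique-⊆⇒length-≤ unique xs⊆ys₁++ys₂)) (≤-reflexive (sym length-split))
  where
  xs⊆ys₁++ys₂ : xs ⊆ ys₁ ++ ys₂
  xs⊆ys₁++ys₂ {y} y∈xs with ∈-++⁻ ys₁ (x∷xs⊆ys (there y∈xs))
  ... | inj₁ y∈ys₁             = ∈-++⁺ˡ y∈ys₁
  ... | inj₂ (here refl)       = contradiction refl (All.lookup x∉xs y∈xs)
  ... | inj₂ (there y∈ys₂)     = ∈-++⁺ʳ ys₁ y∈ys₂
  length-split : length (ys₁ ++ x ∷ ys₂) ≡ suc (length (ys₁ ++ ys₂))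
  length-split = begin
    length (ys₁ ++ x ∷ ys₂)             ≡⟨ length-++ ys₁ ⟩
    length ys₁ + suc (length ys₂)        ≡⟨ +-suc (length ys₁) (length ys₂) ⟩
    suc (length ys₁ + length ys₂)        ≡⟨ cong suc (sym (length-++ ys₁)) ⟩
    suc (length (ys₁ ++ ys₂))            ∎
    where open ≡-Reasoning

missing-element : ∀ {k} (xs : List (Fin k)) → length xs < k → ∃[ c ] c ∉ xs
missing-element {k} xs short = ¬∀⟶∃¬ k (_∈ xs) (λ c → member? _≟_ c xs) not-all-used
  where
  not-all-used : ¬ (∀ c → c ∈ xs)
  not-all-used all-used = <-irrefl refl (≤-trans short k≤length)
    where
    k≤length : k ≤ length xs
    k≤length = subst (_≤ length xs) (length-tabulate (λ c → c))
                 (unique-⊆⇒length-≤ (allFin⁺ k) (λ {c} _ → all-used c))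

other-of-two : ∀ {A : Set} {a : A} (xs : List A) → length xs ≡ 2 → a ∈ xs → ∃[ b ] xs ⊆ a ∷ b ∷ []
other-of-two (p ∷ q ∷ []) _ (here refl)         = q , λ b∈ → b∈
other-of-two (p ∷ q ∷ []) _ (there (here refl)) = p , λ { (here refl) → there (here refl)
                                                       ; (there (here refl)) → here refl }

count-≡-length-filter : ∀ {A : Set} {n} (q : A → Bool) (f : Fin n → A) →
                        count (q ∘ f) ≡ length (filter (T? ∘ q) (tabulate f))
count-≡-length-filter {n = zero}  q f = refl
count-≡-length-filter {n = suc n} q f with q (f zero)
... | true  = cong suc (count-≡-length-filter q (f ∘ suc))
... | false = count-≡-length-filter q (f ∘ suc)

module _ {n} (G : Graph n) where

  neighbours : Fin n → List (Fin n)
  neighbours z = filter (T? ∘ adj G z) (allFin n)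

  length-neighbours : ∀ z → length (neighbours z) ≡ deg G z
  length-neighbours z = sym (count-≡-length-filter (adj G z) (λ a → a))

  ∈-neighbours : ∀ {z a} → Adj G z a → a ∈ neighbours z
  ∈-neighbours {a = a} za = ∈-filter⁺ (T? ∘ adj G _) (∈-allFin a) za

  neighbours-unique : ∀ z → Unique (neighbours z)
  neighbours-unique z = filter⁺ (T? ∘ adj G z) (allFin⁺ n)

  deg-≤-length : ∀ {z} {xs : List (Fin n)} → (∀ {a} → Adj G z a → a ∈ xs) → deg G z ≤ length xs
  deg-≤-length {z} covers = subst (_≤ _) (length-neighbours z)
    (unique-⊆⇒length-≤ (neighbours-unique z) (λ a∈ → covers (proj₂ (∈-filter⁻ (T? ∘ adj G z) {xs = allFin n} a∈))))

  length-≤-deg : ∀ {z} {xs : List (Fin n)} → Unique xs → All (Adj G z) xs → length xs ≤ deg G z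
  length-≤-deg {z} unique adjacent = subst (_ ≤_) (length-neighbours z)
    (unique-⊆⇒length-≤ unique (λ a∈ → ∈-neighbours (All.lookup adjacent a∈)))

  neighbours-within : ∀ {z} {xs : List (Fin n)} → Unique xs → All (Adj G z) xs → length xs ≡ deg G z →
                      ∀ {a} → Adj G z a → a ∈ xs
  neighbours-within {z} {xs} unique adjacent full {a} za with member? _≟_ a xs
  ... | yes a∈xs = a∈xs
  ... | no  a∉xs = contradiction (length-≤-deg (¬Any⇒All¬ xs a∉xs ∷ unique) (za ∷ adjacent))
                                 (λ le → <-irrefl full le)

  neighbours-of-degree-two : ∀ {z a} → deg G z ≡ 2 → Adj G z a → ∃[ b ] (∀ {c} → Adj G z c → c ∈ a ∷ b ∷ [])
  neighbours-of-degree-two {z} two za with other-of-two (neighbours z) (trans (length-neighbours z) two) (∈-neighbours za)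
  ... | b , ⊆ab = b , λ zc → ⊆ab (∈-neighbours zc)

-- Partial total colourings

Edge : ℕ → Set
Edge n = Fin n × Fin n

Joins : ∀ {n} → Edge n → Fin n → Fin n → Set
Joins (p , q) a b = (a ≡ p × b ≡ q) ⊎ (a ≡ q × b ≡ p)

joins? : ∀ {n} (e : Edge n) a b → Dec (Joins e a b)
joins? (p , q) a b = (a ≟ p ×-dec b ≟ q) ⊎-dec (a ≟ q ×-dec b ≟ p)

Joins-swap : ∀ {n} {e : Edge n} {a b} → Joins e a b → Joins e b a
Joins-swap (inj₁ (refl , refl)) = inj₂ (refl , refl)
Joins-swap (inj₂ (refl , refl)) = inj₁ (refl , refl)

Joins-endpoint : ∀ {n} {p q a b : Fin n} → Joins (p , q) a b → a ≡ p ⊎ a ≡ q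
Joins-endpoint (inj₁ (a≡p , _)) = inj₁ a≡p
Joins-endpoint (inj₂ (a≡q , _)) = inj₂ a≡q

OneOf : ∀ {n} → List (Edge n) → Fin n → Fin n → Set
OneOf es a b = Any (λ e → Joins e a b) es

oneOf? : ∀ {n} (es : List (Edge n)) a b → Dec (OneOf es a b)
oneOf? es a b = any? (λ e → joins? e a b) es

OneOf-swap : ∀ {n} {es : List (Edge n)} {a b} → OneOf es a b → OneOf es b a
OneOf-swap = Any.map Joins-swap

isPair-false : ∀ {n} {p q a b : Fin n} → ¬ Joins (p , q) a b → isPair p q a b ≡ false
isPair-false {p = p} {q} {a} {b} ¬joins with a ≟ p | b ≟ q | a ≟ q | b ≟ p
... | yes a≡p | yes b≡q | _       | _       = contradiction (inj₁ (a≡p , b≡q)) ¬joins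
... | _       | _       | yes a≡q | yes b≡p = contradiction (inj₂ (a≡q , b≡p)) ¬joins
... | no _    | _       | no _    | _       = refl
... | no _    | _       | yes _   | no _    = refl
... | yes _   | no _    | no _    | _       = refl
... | yes _   | no _    | yes _   | no _    = refl

Adj-deleteEdge : ∀ {n} (G : Graph n) {p q a b} → Adj G a b → ¬ Joins (p , q) a b → Adj (deleteEdge G p q) a b
Adj-deleteEdge G {p} {q} {a} {b} ab ¬joins rewrite isPair-false ¬joins with adj G a b
... | true = tt

Adj-irrefl : ∀ {n} (G : Graph n) {a b} → Adj G a b → a ≢ b
Adj-irrefl G {a} ab refl rewrite adj-irr G a = ab

Adj-sym : ∀ {n} (G : Graph n) {a b} → Adj G a b → Adj G b a
Adj-sym G {a} {b} ab rewrite adj-sym G b a = ab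

if-does-cases : ∀ {A P : Set} (d : Dec P) (x y : A) →
                (P × (if does d then x else y) ≡ x) ⊎ (¬ P × (if does d then x else y) ≡ y)
if-does-cases (yes p) x y = inj₁ (p , refl)
if-does-cases (no ¬p) x y = inj₂ (¬p , refl)

just≢nothing : ∀ {A : Set} {a : A} → just a ≢ nothing
just≢nothing ()

≡nothing⇒≢just : ∀ {A : Set} {m : Maybe A} {a} → m ≡ nothing → m ≢ just a
≡nothing⇒≢just m≡nothing m≡just = just≢nothing (trans (sym m≡just) m≡nothing)

≡just⇒≢just : ∀ {A : Set} {m : Maybe A} {a a′} → m ≡ just a → a ≢ a′ → m ≢ just a′
≡just⇒≢just m≡a a≢a′ m≡a′ = a≢a′ (just-injective (trans (sym m≡a) m≡a′))

∈-catMaybes⁺ : ∀ {A : Set} {a : A} {ms} → just a ∈ ms → a ∈ catMaybes ms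
∈-catMaybes⁺ = Any-catMaybes⁺ ∘ Any.map λ { refl → just-any refl }

unused-colour : ∀ {k} (ms : List (Maybe (Fin k))) → length (catMaybes ms) < k → ∃[ c ] just c ∉ ms
unused-colour ms short = Product.map₂ (_∘ ∈-catMaybes⁺) (missing-element (catMaybes ms) short)

length-catMaybes-∷ : ∀ {A : Set} (m : Maybe A) ms → length (catMaybes (m ∷ ms)) ≤ suc (length (catMaybes ms))
length-catMaybes-∷ (just _) ms = ≤-refl
length-catMaybes-∷ nothing  ms = m≤n⇒m≤1+n ≤-refl

length-catMaybes-< : ∀ {A : Set} {ms : List (Maybe A)} → nothing ∈ ms → length (catMaybes ms) < length ms
length-catMaybes-< {ms = nothing ∷ ms} (here refl) = s≤s (length-catMaybes ms)
length-catMaybes-< {ms = just _  ∷ ms} (there m)   = s≤s (length-catMaybes-< m)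
length-catMaybes-< {ms = nothing ∷ ms} (there m)   = m≤n⇒m≤1+n (length-catMaybes-< m)

module PartialColourings {n} (G : Graph n) (k : ℕ) where

  -- nothing marks an uncoloured vertex or edge; vs and es contain all of them.
  record PartialColouring (vs : List (Fin n)) (es : List (Edge n)) : Set where
    field
      vcol     : Fin n → Maybe (Fin k)
      ecol     : Fin n → Fin n → Maybe (Fin k)
      ecol-sym : ∀ a b → ecol a b ≡ ecol b a
      vv       : ∀ {a b c} → Adj G a b → vcol a ≡ just c → vcol b ≢ just c
      ve       : ∀ {a b c} → Adj G a b → vcol a ≡ just c → ecol a b ≢ just c
      ee       : ∀ {a b b′ c} → Adj G a b → Adj G a b′ → b ≢ b′ → ecol a b ≡ just c → ecol a b′ ≢ just c
      vertices-coloured : ∀ {a} → vcol a ≡ nothing → a ∈ vs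
      edges-coloured    : ∀ {a b} → Adj G a b → ecol a b ≡ nothing → OneOf es a b

  open PartialColouring public

  private
    variable
      vs : List (Fin n)
      es : List (Edge n)

  Free : PartialColouring vs es → Fin n → Fin k → Set
  Free φ a c = vcol φ a ≢ just c × (∀ {b} → Adj G a b → ecol φ a b ≢ just c)

  VertexFree : PartialColouring vs es → Fin n → Fin k → Set
  VertexFree φ z c = (∀ {a} → Adj G z a → vcol φ a ≢ just c) × (∀ {a} → Adj G z a → ecol φ z a ≢ just c)

  colours-distinct : ∀ (φ : PartialColouring vs es) {a b b′ c c′} → Adj G a b → Adj G a b′ → b ≢ b′ →
                     ecol φ a b ≡ just c → ecol φ a b′ ≡ just c′ → c ≢ c′
  colours-distinct φ ab ab′ b≢b′ eb eb′ refl = ee φ ab ab′ b≢b′ eb eb′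

  missing-colour : ∀ (φ : PartialColouring vs es) {a b} → deg G a < k → Adj G a b → ecol φ a b ≡ nothing →
                   ∃[ c ] Free φ a c
  missing-colour φ {a} small ab uncoloured =
    Product.map₂ (λ c∉ → (λ e → c∉ (here (sym e))) , (λ ab′ e → c∉ (there (∈-edgeColours ab′ e))))
                 (unused-colour seen (≤-trans (s≤s few-seen) small))
    where
    edgeColours seen : List (Maybe (Fin k))
    edgeColours = map (ecol φ a) (neighbours G a)
    seen = vcol φ a ∷ edgeColours
    ∈-edgeColours : ∀ {b c} → Adj G a b → ecol φ a b ≡ c → c ∈ edgeColours
    ∈-edgeColours ab e = subst (_∈ edgeColours) e (∈-map⁺ (ecol φ a) (∈-neighbours G ab))
    few-seen : length (catMaybes seen) ≤ deg G a
    few-seen = begin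
      length (catMaybes seen)              ≤⟨ length-catMaybes-∷ (vcol φ a) edgeColours ⟩
      suc (length (catMaybes edgeColours)) ≤⟨ length-catMaybes-< (∈-edgeColours ab uncoloured) ⟩
      length edgeColours                   ≡⟨ length-map (ecol φ a) (neighbours G a) ⟩
      length (neighbours G a)              ≡⟨ length-neighbours G a ⟩
      deg G a                              ∎
      where open ≤-Reasoning

  free-vertex-colour : ∀ (φ : PartialColouring vs es) {z} → deg G z + deg G z < k → ∃[ c ] VertexFree φ z c
  free-vertex-colour φ {z} small =
    Product.map₂ (λ c∉ → (λ za e → c∉ (∈-++⁺ˡ (∈-colours (vcol φ) za e)))
                       , (λ za e → c∉ (∈-++⁺ʳ vertexColours (∈-colours (ecol φ z) za e))))
                 (unused-colour seen (≤-trans (s≤s few-seen) small))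
    where
    vertexColours edgeColours seen : List (Maybe (Fin k))
    vertexColours = map (vcol φ) (neighbours G z)
    edgeColours   = map (ecol φ z) (neighbours G z)
    seen          = vertexColours ++ edgeColours
    ∈-colours : ∀ (f : Fin n → Maybe (Fin k)) {a c} → Adj G z a → f a ≡ c → c ∈ map f (neighbours G z)
    ∈-colours f za e = subst (_∈ map f (neighbours G z)) e (∈-map⁺ f (∈-neighbours G za))
    few-seen : length (catMaybes seen) ≤ deg G z + deg G z
    few-seen = begin
      length (catMaybes seen)                           ≤⟨ length-catMaybes seen ⟩
      length seen                                       ≡⟨ length-++ vertexColours ⟩
      length vertexColours + length edgeColours         ≡⟨ cong₂ _+_ (length-map (vcol φ) (neighbours G z))
                                                                     (length-map (ecol φ z) (neighbours G z)) ⟩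
      length (neighbours G z) + length (neighbours G z) ≡⟨ cong₂ _+_ (length-neighbours G z) (length-neighbours G z) ⟩
      deg G z + deg G z                                 ∎
      where open ≤-Reasoning

  module Erasure (φ : PartialColouring vs es) (hs : List (Edge n)) where

    private
      ecol′ : Fin n → Fin n → Maybe (Fin k)
      ecol′ a b = if does (oneOf? hs a b) then nothing else ecol φ a b

      ecol-erase : ∀ a b → (OneOf hs a b × ecol′ a b ≡ nothing) ⊎ (¬ OneOf hs a b × ecol′ a b ≡ ecol φ a b)
      ecol-erase a b = if-does-cases (oneOf? hs a b) nothing (ecol φ a b)

      ecol′-sym : ∀ a b → ecol′ a b ≡ ecol′ b a
      ecol′-sym a b with ecol-erase a b | ecol-erase b a
      ... | inj₁ (_ , e)     | inj₁ (_ , e′)    = trans e (sym e′)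
      ... | inj₁ (hab , _)   | inj₂ (¬hba , _)  = contradiction (OneOf-swap hab) ¬hba
      ... | inj₂ (¬hab , _)  | inj₁ (hba , _)   = contradiction (OneOf-swap hba) ¬hab
      ... | inj₂ (_ , e)     | inj₂ (_ , e′)    = trans e (trans (ecol-sym φ a b) (sym e′))

      ve′ : ∀ {a b c} → Adj G a b → vcol φ a ≡ just c → ecol′ a b ≢ just c
      ve′ {a} {b} ab va with ecol-erase a b
      ... | inj₁ (_ , e) = ≡nothing⇒≢just e
      ... | inj₂ (_ , e) = λ e′ → ve φ ab va (trans (sym e) e′)

      ee′ : ∀ {a b b′ c} → Adj G a b → Adj G a b′ → b ≢ b′ → ecol′ a b ≡ just c → ecol′ a b′ ≢ just c
      ee′ {a} {b} {b′} ab ab′ b≢b′ with ecol-erase a b | ecol-erase a b′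
      ... | inj₁ (_ , e) | _            = λ eb → contradiction eb (≡nothing⇒≢just e)
      ... | inj₂ _       | inj₁ (_ , e) = λ _ → ≡nothing⇒≢just e
      ... | inj₂ (_ , e) | inj₂ (_ , e′) = λ eb eb′ → ee φ ab ab′ b≢b′ (trans (sym e) eb) (trans (sym e′) eb′)

      edges-coloured′ : ∀ {a b} → Adj G a b → ecol′ a b ≡ nothing → OneOf (hs ++ es) a b
      edges-coloured′ {a} {b} ab with ecol-erase a b
      ... | inj₁ (hab , _) = λ _ → ++⁺ˡ hab
      ... | inj₂ (_ , e)   = λ eab → ++⁺ʳ hs (edges-coloured φ ab (trans (sym e) eab))

    erase : PartialColouring vs (hs ++ es)
    erase = record
      { vcol = vcol φ
      ; ecol = ecol′
      ; ecol-sym = ecol′-sym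
      ; vv = vv φ
      ; ve = ve′
      ; ee = ee′
      ; vertices-coloured = vertices-coloured φ
      ; edges-coloured = edges-coloured′ }

    Free⁺ : ∀ {a c} → Free φ a c → Free erase a c
    Free⁺ {a} (va , ea) = va , edges
      where
      edges : ∀ {b} → Adj G a b → ecol′ a b ≢ just _
      edges {b} ab with ecol-erase a b
      ... | inj₁ (_ , e) = ≡nothing⇒≢just e
      ... | inj₂ (_ , e) = λ e′ → ea ab (trans (sym e) e′)

    private
      frees-endpoint : ∀ {a b c} → Adj G a b → OneOf hs a b → ecol φ a b ≡ just c → Free erase a c
      frees-endpoint {a} {b} ab hab eab = (λ va → ve φ ab va eab) , edges
        where
        edges : ∀ {b′} → Adj G a b′ → ecol′ a b′ ≢ just _
        edges {b′} ab′ with ecol-erase a b′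
        ... | inj₁ (_ , e)     = ≡nothing⇒≢just e
        ... | inj₂ (¬hab′ , e) = λ e′ → ee φ ab ab′ (λ { refl → ¬hab′ hab }) eab (trans (sym e) e′)

    frees : ∀ {p q c} → (p , q) ∈ hs → Adj G p q → ecol φ p q ≡ just c → Free erase p c × Free erase q c
    frees {p} {q} pq∈hs pq epq =
      frees-endpoint pq erased epq ,
      frees-endpoint (Adj-sym G pq) (OneOf-swap erased) (trans (ecol-sym φ q p) epq)
      where
      erased : OneOf hs p q
      erased = Any.map (λ { refl → inj₁ (refl , refl) }) pq∈hs

  module Colouring {p q : Fin n} (φ : PartialColouring vs ((p , q) ∷ es)) (c : Fin k) (p≢q : p ≢ q)
           (free-p : Free φ p c) (free-q : Free φ q c) where

    private
      ecol′ : Fin n → Fin n → Maybe (Fin k)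
      ecol′ a b = if does (joins? (p , q) a b) then just c else ecol φ a b

      ecol-colour : ∀ a b → (Joins (p , q) a b × ecol′ a b ≡ just c) ⊎ (¬ Joins (p , q) a b × ecol′ a b ≡ ecol φ a b)
      ecol-colour a b = if-does-cases (joins? (p , q) a b) (just c) (ecol φ a b)

      free-at-endpoint : ∀ {a b} → Joins (p , q) a b → Free φ a c
      free-at-endpoint (inj₁ (refl , _)) = free-p
      free-at-endpoint (inj₂ (refl , _)) = free-q

      same-edge : ∀ {a b b′} → Joins (p , q) a b → Joins (p , q) a b′ → b ≡ b′
      same-edge (inj₁ (_ , refl)) (inj₁ (_ , refl)) = refl
      same-edge (inj₁ (refl , _)) (inj₂ (a≡q , _))  = contradiction a≡q p≢q
      same-edge (inj₂ (refl , _)) (inj₁ (a≡p , _))  = contradiction (sym a≡p) p≢q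
      same-edge (inj₂ (_ , refl)) (inj₂ (_ , refl)) = refl

      ecol′-sym : ∀ a b → ecol′ a b ≡ ecol′ b a
      ecol′-sym a b with ecol-colour a b | ecol-colour b a
      ... | inj₁ (_ , e)  | inj₁ (_ , e′)  = trans e (sym e′)
      ... | inj₁ (j , _)  | inj₂ (¬j , _)  = contradiction (Joins-swap j) ¬j
      ... | inj₂ (¬j , _) | inj₁ (j , _)   = contradiction (Joins-swap j) ¬j
      ... | inj₂ (_ , e)  | inj₂ (_ , e′)  = trans e (trans (ecol-sym φ a b) (sym e′))

      ve′ : ∀ {a b c′} → Adj G a b → vcol φ a ≡ just c′ → ecol′ a b ≢ just c′
      ve′ {a} {b} ab va with ecol-colour a b
      ... | inj₁ (j , e) = λ e′ → proj₁ (free-at-endpoint j) (trans va (sym (trans (sym e) e′)))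
      ... | inj₂ (_ , e) = λ e′ → ve φ ab va (trans (sym e) e′)

      ee′ : ∀ {a b b′ c′} → Adj G a b → Adj G a b′ → b ≢ b′ → ecol′ a b ≡ just c′ → ecol′ a b′ ≢ just c′
      ee′ {a} {b} {b′} ab ab′ b≢b′ with ecol-colour a b | ecol-colour a b′
      ... | inj₁ (j , _) | inj₁ (j′ , _) = contradiction (same-edge j j′) b≢b′
      ... | inj₁ (j , e) | inj₂ (_ , e′) = λ eb eb′ →
            proj₂ (free-at-endpoint j) ab′ (trans (sym e′) (trans eb′ (trans (sym eb) e)))
      ... | inj₂ (_ , e) | inj₁ (j′ , e′) = λ eb eb′ →
            proj₂ (free-at-endpoint j′) ab (trans (sym e) (trans eb (trans (sym eb′) e′)))
      ... | inj₂ (_ , e) | inj₂ (_ , e′) = λ eb eb′ → ee φ ab ab′ b≢b′ (trans (sym e) eb) (trans (sym e′) eb′)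

      edges-coloured′ : ∀ {a b} → Adj G a b → ecol′ a b ≡ nothing → OneOf es a b
      edges-coloured′ {a} {b} ab with ecol-colour a b
      ... | inj₁ (_ , e)  = λ e′ → contradiction (trans (sym e) e′) just≢nothing
      ... | inj₂ (¬j , e) = λ eab → Any-tail (edges-coloured φ ab (trans (sym e) eab))
        where
        Any-tail : OneOf ((p , q) ∷ es) a b → OneOf es a b
        Any-tail (here j)  = contradiction j ¬j
        Any-tail (there x) = x

    colour : PartialColouring vs es
    colour = record
      { vcol = vcol φ
      ; ecol = ecol′
      ; ecol-sym = ecol′-sym
      ; vv = vv φ
      ; ve = ve′
      ; ee = ee′
      ; vertices-coloured = vertices-coloured φ
      ; edges-coloured = edges-coloured′ }

    Free⁺ : ∀ {a c′} → Free φ a c′ → c ≢ c′ → Free colour a c′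
    Free⁺ {a} (va , ea) c≢c′ = va , edges
      where
      edges : ∀ {b} → Adj G a b → ecol′ a b ≢ just _
      edges {b} ab with ecol-colour a b
      ... | inj₁ (_ , e) = ≡just⇒≢just e c≢c′
      ... | inj₂ (_ , e) = λ e′ → ea ab (trans (sym e) e′)

    Free⁺-apart : ∀ {a c′} → Free φ a c′ → a ≢ p → a ≢ q → Free colour a c′
    Free⁺-apart {a} (va , ea) a≢p a≢q = va , edges
      where
      edges : ∀ {b} → Adj G a b → ecol′ a b ≢ just _
      edges {b} ab with ecol-colour a b
      ... | inj₁ (j , _) = λ _ → [ a≢p , a≢q ]′ (Joins-endpoint j)
      ... | inj₂ (_ , e) = λ e′ → ea ab (trans (sym e) e′)

  module _ {z} (φ : PartialColouring (z ∷ vs) es) (c : Fin k) (free : VertexFree φ z c) where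

    private
      vcol′ : Fin n → Maybe (Fin k)
      vcol′ a = if does (a ≟ z) then just c else vcol φ a

      vcol-cases : ∀ a → (a ≡ z × vcol′ a ≡ just c) ⊎ (a ≢ z × vcol′ a ≡ vcol φ a)
      vcol-cases a = if-does-cases (a ≟ z) (just c) (vcol φ a)

      vv′ : ∀ {a b c′} → Adj G a b → vcol′ a ≡ just c′ → vcol′ b ≢ just c′
      vv′ {a} {b} ab with vcol-cases a | vcol-cases b
      ... | inj₁ (refl , _) | inj₁ (refl , _) = contradiction refl (Adj-irrefl G ab)
      ... | inj₁ (refl , e) | inj₂ (_ , e′)   = λ va vb → proj₁ free ab (trans (sym e′) (trans vb (trans (sym va) e)))
      ... | inj₂ (_ , e)    | inj₁ (refl , e′) = λ va vb →
            proj₁ free (Adj-sym G ab) (trans (sym e) (trans va (trans (sym vb) e′)))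
      ... | inj₂ (_ , e)    | inj₂ (_ , e′)   = λ va vb → vv φ ab (trans (sym e) va) (trans (sym e′) vb)

      ve′ : ∀ {a b c′} → Adj G a b → vcol′ a ≡ just c′ → ecol φ a b ≢ just c′
      ve′ {a} {b} ab with vcol-cases a
      ... | inj₁ (refl , e) = λ va eb → proj₂ free ab (trans eb (trans (sym va) e))
      ... | inj₂ (_ , e)    = λ va → ve φ ab (trans (sym e) va)

      vertices-coloured′ : ∀ {a} → vcol′ a ≡ nothing → a ∈ vs
      vertices-coloured′ {a} with vcol-cases a
      ... | inj₁ (_ , e)   = λ e′ → contradiction (trans (sym e) e′) just≢nothing
      ... | inj₂ (a≢z , e) = λ e′ → drop-head (vertices-coloured φ (trans (sym e) e′))
        where
        drop-head : a ∈ z ∷ vs → a ∈ vs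
        drop-head (here a≡z) = contradiction a≡z a≢z
        drop-head (there a∈) = a∈

    colourVertex : PartialColouring vs es
    colourVertex = record
      { vcol = vcol′
      ; ecol = ecol φ
      ; ecol-sym = ecol-sym φ
      ; vv = vv′
      ; ve = ve′
      ; ee = ee φ
      ; vertices-coloured = vertices-coloured′
      ; edges-coloured = edges-coloured φ }

  -- q is left uncoloured because ψ may give p and q the same colour.
  module Restriction {p q : Fin n} (ψ : TotalColoring k (deleteEdge G p q)) (zs : List (Fin n)) (q∈zs : q ∈ zs) where

    private
      module ψ = TotalColoring ψ

      vcol′ : Fin n → Maybe (Fin k)
      vcol′ a = if does (member? _≟_ a zs) then nothing else just (ψ.vcol a)

      vcol-cases : ∀ a → (a ∈ zs × vcol′ a ≡ nothing) ⊎ (a ∉ zs × vcol′ a ≡ just (ψ.vcol a))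
      vcol-cases a = if-does-cases (member? _≟_ a zs) nothing (just (ψ.vcol a))

      ecol′ : Fin n → Fin n → Maybe (Fin k)
      ecol′ a b = if does (joins? (p , q) a b) then nothing else just (ψ.ecol a b)

      ecol-restrict : ∀ a b → (Joins (p , q) a b × ecol′ a b ≡ nothing) ⊎ (¬ Joins (p , q) a b × ecol′ a b ≡ just (ψ.ecol a b))
      ecol-restrict a b = if-does-cases (joins? (p , q) a b) nothing (just (ψ.ecol a b))

      ecol′-sym : ∀ a b → ecol′ a b ≡ ecol′ b a
      ecol′-sym a b with ecol-restrict a b | ecol-restrict b a
      ... | inj₁ (_ , e)  | inj₁ (_ , e′)  = trans e (sym e′)
      ... | inj₁ (j , _)  | inj₂ (¬j , _)  = contradiction (Joins-swap j) ¬j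
      ... | inj₂ (¬j , _) | inj₁ (j , _)   = contradiction (Joins-swap j) ¬j
      ... | inj₂ (_ , e)  | inj₂ (_ , e′)  = trans e (trans (cong just (ψ.ecol-sym a b)) (sym e′))

      not-joins : ∀ {a b} → a ∉ zs → b ∉ zs → ¬ Joins (p , q) a b
      not-joins a∉ b∉ (inj₁ (_ , refl)) = b∉ q∈zs
      not-joins a∉ b∉ (inj₂ (refl , _)) = a∉ q∈zs

      vv′ : ∀ {a b c} → Adj G a b → vcol′ a ≡ just c → vcol′ b ≢ just c
      vv′ {a} {b} ab with vcol-cases a | vcol-cases b
      ... | inj₁ (_ , e)    | _              = λ va → contradiction va (≡nothing⇒≢just e)
      ... | inj₂ _          | inj₁ (_ , e′)  = λ _ → ≡nothing⇒≢just e′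
      ... | inj₂ (a∉ , e)   | inj₂ (b∉ , e′) = λ va vb →
            ψ.vv a b (Adj-deleteEdge G ab (not-joins a∉ b∉))
                 (just-injective (trans (trans (sym e) va) (sym (trans (sym e′) vb))))

      ve′ : ∀ {a b c} → Adj G a b → vcol′ a ≡ just c → ecol′ a b ≢ just c
      ve′ {a} {b} ab with vcol-cases a | ecol-restrict a b
      ... | inj₁ (_ , e) | _              = λ va → contradiction va (≡nothing⇒≢just e)
      ... | inj₂ _       | inj₁ (_ , e′)  = λ _ → ≡nothing⇒≢just e′
      ... | inj₂ (_ , e) | inj₂ (¬j , e′) = λ va eb →
            ψ.ve a b (Adj-deleteEdge G ab ¬j) (just-injective (trans (trans (sym e) va) (sym (trans (sym e′) eb))))

      ee′ : ∀ {a b b′ c} → Adj G a b → Adj G a b′ → b ≢ b′ → ecol′ a b ≡ just c → ecol′ a b′ ≢ just c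
      ee′ {a} {b} {b′} ab ab′ b≢b′ with ecol-restrict a b | ecol-restrict a b′
      ... | inj₁ (_ , e)  | _               = λ eb → contradiction eb (≡nothing⇒≢just e)
      ... | inj₂ _        | inj₁ (_ , e′)   = λ _ → ≡nothing⇒≢just e′
      ... | inj₂ (¬j , e) | inj₂ (¬j′ , e′) = λ eb eb′ →
            ψ.ee a b b′ (Adj-deleteEdge G ab ¬j) (Adj-deleteEdge G ab′ ¬j′) b≢b′
                 (just-injective (trans (trans (sym e) eb) (sym (trans (sym e′) eb′))))

      vertices-coloured′ : ∀ {a} → vcol′ a ≡ nothing → a ∈ zs
      vertices-coloured′ {a} with vcol-cases a
      ... | inj₁ (a∈ , _) = λ _ → a∈
      ... | inj₂ (_ , e)  = λ e′ → contradiction (trans (sym e) e′) (λ ())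

      edges-coloured′ : ∀ {a b} → Adj G a b → ecol′ a b ≡ nothing → OneOf ((p , q) ∷ []) a b
      edges-coloured′ {a} {b} _ with ecol-restrict a b
      ... | inj₁ (j , _) = λ _ → here j
      ... | inj₂ (_ , e) = λ e′ → contradiction (trans (sym e) e′) (λ ())

    restrict : PartialColouring zs ((p , q) ∷ [])
    restrict = record
      { vcol = vcol′
      ; ecol = ecol′
      ; ecol-sym = ecol′-sym
      ; vv = vv′
      ; ve = ve′
      ; ee = ee′
      ; vertices-coloured = vertices-coloured′
      ; edges-coloured = edges-coloured′ }

    restrict-uncoloured : ecol restrict p q ≡ nothing
    restrict-uncoloured with ecol-restrict p q
    ... | inj₁ (_ , e)  = e
    ... | inj₂ (¬j , _) = contradiction (inj₁ (refl , refl)) ¬j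

    restrict-coloured : ∀ {a b} → ¬ Joins (p , q) a b → ecol restrict a b ≡ just (ψ.ecol a b)
    restrict-coloured {a} {b} ¬j with ecol-restrict a b
    ... | inj₁ (j , _) = contradiction j ¬j
    ... | inj₂ (_ , e) = e

    restrict-uncoloured-vertex : ∀ {a} → a ∈ zs → vcol restrict a ≡ nothing
    restrict-uncoloured-vertex {a} a∈ with vcol-cases a
    ... | inj₁ (_ , e)   = e
    ... | inj₂ (a∉ , _) = contradiction a∈ a∉

  -- The given colour is only used for pairs of non-adjacent vertices.
  complete : Fin k → PartialColouring [] [] → TotalColoring k G
  complete default φ = record
    { vcol = fromMaybe default ∘ vcol φ
    ; ecol = λ a b → fromMaybe default (ecol φ a b)
    ; ecol-sym = λ a b → cong (fromMaybe default) (ecol-sym φ a b)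
    ; vv = λ a b ab eq → vv φ ab (proj₂ (vertex a)) (same-colour (proj₂ (vertex b)) (proj₂ (vertex a)) (sym eq))
    ; ve = λ a b ab eq → ve φ ab (proj₂ (vertex a)) (same-colour (proj₂ (edge ab)) (proj₂ (vertex a)) (sym eq))
    ; ee = λ a b b′ ab ab′ b≢b′ eq → ee φ ab ab′ b≢b′ (proj₂ (edge ab)) (same-colour (proj₂ (edge ab′)) (proj₂ (edge ab)) (sym eq)) }
    where
    vertex : ∀ a → ∃[ c ] vcol φ a ≡ just c
    vertex a with vcol φ a in e
    ... | just c  = c , refl
    ... | nothing = contradiction (vertices-coloured φ e) (λ ())
    edge : ∀ {a b} → Adj G a b → ∃[ c ] ecol φ a b ≡ just c
    edge {a} {b} ab with ecol φ a b in e
    ... | just c  = c , refl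
    ... | nothing = contradiction (edges-coloured φ ab e) (λ ())
    same-colour : ∀ {m m′ : Maybe (Fin k)} {c c′} → m ≡ just c → m′ ≡ just c′ →
                  fromMaybe default m ≡ fromMaybe default m′ → m ≡ just c′
    same-colour refl refl eq = cong just eq

module _ {n} {G : Graph n} (R : RotationSystem G) where

  triangle : ∀ {a b} → FaceLength R (a , b) 3 → rot R (rot R b a) b ≡ a × rot R a (rot R b a) ≡ b
  triangle {a} {b} (_ , closed , _) = first , trans (cong (λ t → rot R t (rot R b a)) (sym first)) (cong proj₂ closed)
    where
    first : rot R (rot R b a) b ≡ a
    first = cong proj₁ closed

  apex-adjacent : ∀ {a b} → FaceLength R (a , b) 3 → Adj G a b → Adj G a (rot R b a) × Adj G b (rot R b a)
  apex-adjacent {a} {b} face ab = Adj-sym G (subst (Adj G (rot R b a)) (proj₁ (triangle face)) xa) , bx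
    where
    bx : Adj G b (rot R b a)
    bx = rot-adj R b a (Adj-sym G ab)
    xa : Adj G (rot R b a) (rot R (rot R b a) b)
    xa = rot-adj R (rot R b a) b (Adj-sym G bx)

  apexes-distinct : ∀ {v w} → FaceLength R (w , v) 3 → Adj G v w → 2 < deg G w → rot R w v ≢ rot R v w
  apexes-distinct {v} {w} face vw big x≡y = <-irrefl refl (<-≤-trans big (deg-≤-length G covered))
    where
    x : Fin n
    x = rot R w v
    rot-x : rot R w x ≡ v
    rot-x = trans (cong (rot R w) x≡y) (proj₂ (triangle face))
    orbit : ∀ i → iter (rot R w) i v ∈ v ∷ x ∷ []
    orbit zero = here refl
    orbit (suc i) with orbit i
    ... | here e         = there (here (cong (rot R w) e))
    ... | there (here e) = here (trans (cong (rot R w) e) rot-x)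
    covered : ∀ {a} → Adj G w a → a ∈ v ∷ x ∷ []
    covered wa with i , e ← rot-cyclic R w v _ (Adj-sym G vw) wa = subst (_∈ v ∷ x ∷ []) e (orbit i)

-- The recolouring argument

module Reducible {n} {G : Graph n} {v w u x′ : Fin n} (ψ : TotalColoring 9 (deleteEdge G v u))
  (vu : Adj G v u) (vw : Adj G v w) (u≢w : u ≢ w) (deg-v : deg G v ≤ 8) (deg-w : deg G w ≤ 4) (deg-u : deg G u ≤ 4)
  (around-u : ∀ {a} → Adj G u a → a ∈ v ∷ x′ ∷ []) where

  open PartialColourings G 9
  module ψ = TotalColoring ψ

  open Restriction ψ (w ∷ u ∷ []) (there (here refl))

  φ₀ : PartialColouring (w ∷ u ∷ []) ((v , u) ∷ [])
  φ₀ = restrict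

  vu-uncoloured : ecol φ₀ v u ≡ nothing
  vu-uncoloured = restrict-uncoloured

  w-uncoloured : vcol φ₀ w ≡ nothing
  w-uncoloured = restrict-uncoloured-vertex (here refl)

  u-uncoloured : vcol φ₀ u ≡ nothing
  u-uncoloured = restrict-uncoloured-vertex (there (here refl))

  v≢u : v ≢ u
  v≢u = Adj-irrefl G vu

  v≢w : v ≢ w
  v≢w = Adj-irrefl G vw

  ψ-colour : ∀ {a b} → a ≢ v → a ≢ u → ecol φ₀ a b ≡ just (ψ.ecol a b)
  ψ-colour a≢v a≢u = restrict-coloured λ { (inj₁ (a≡v , _)) → a≢v a≡v ; (inj₂ (a≡u , _)) → a≢u a≡u }

  missing-at-v : ∃[ c ] Free φ₀ v c
  missing-at-v = missing-colour φ₀ (s≤s deg-v) vu vu-uncoloured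

  α : Fin 9
  α = proj₁ missing-at-v

  α-at-v : Free φ₀ v α
  α-at-v = proj₂ missing-at-v

  α-unused-at-v : ∀ {a c} → Adj G v a → ecol φ₀ v a ≡ just c → α ≢ c
  α-unused-at-v va e refl = proj₂ α-at-v va e

  free-at-u : ∀ {c} → ecol φ₀ u x′ ≢ just c → Free φ₀ u c
  free-at-u ux′≢c = ≡nothing⇒≢just u-uncoloured , edge
    where
    edge : ∀ {a} → Adj G u a → ecol φ₀ u a ≢ just _
    edge ua with around-u ua
    ... | here refl         = ≡nothing⇒≢just (trans (ecol-sym φ₀ u v) vu-uncoloured)
    ... | there (here refl) = ux′≢c

  recolour-vu : ecol φ₀ u x′ ≢ just α → PartialColouring (w ∷ u ∷ []) []
  recolour-vu ux′≢α = Colouring.colour φ₀ α v≢u α-at-v (free-at-u ux′≢α)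

  module Triangle {X Y : Fin n} (vX : Adj G v X) (wX : Adj G w X) (vY : Adj G v Y) (wY : Adj G w Y) (X≢Y : X ≢ Y)
    (around-w : ∀ {a} → Adj G w a → a ∈ v ∷ X ∷ Y ∷ []) (ux′α : ecol φ₀ u x′ ≡ just α) where

    v≢X : v ≢ X
    v≢X = Adj-irrefl G vX

    v≢Y : v ≢ Y
    v≢Y = Adj-irrefl G vY

    w≢X : w ≢ X
    w≢X = Adj-irrefl G wX

    w≢Y : w ≢ Y
    w≢Y = Adj-irrefl G wY

    β : Fin 9
    β = ψ.ecol w v

    wvβ : ecol φ₀ w v ≡ just β
    wvβ = ψ-colour (≢-sym v≢w) (≢-sym u≢w)

    vwβ : ecol φ₀ v w ≡ just β
    vwβ = trans (ecol-sym φ₀ v w) wvβ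

    α≢β : α ≢ β
    α≢β = α-unused-at-v vw vwβ

    free-at-w : ∀ {c} → β ≢ c → ecol φ₀ w X ≢ just c → ecol φ₀ w Y ≢ just c → Free φ₀ w c
    free-at-w β≢c wX≢c wY≢c = ≡nothing⇒≢just w-uncoloured , edge
      where
      edge : ∀ {a} → Adj G w a → ecol φ₀ w a ≢ just _
      edge wa with around-w wa
      ... | here refl                 = ≡just⇒≢just wvβ β≢c
      ... | there (here refl)         = wX≢c
      ... | there (there (here refl)) = wY≢c

    recolour-vw : ecol φ₀ w X ≢ just α → ecol φ₀ w Y ≢ just α → PartialColouring (w ∷ u ∷ []) []
    recolour-vw wX≢α wY≢α = S₂.colour
      where
      module S₀ = Erasure φ₀ ((v , w) ∷ [])
      β-freed : Free S₀.erase v β × Free S₀.erase w β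
      β-freed = S₀.frees (here refl) vw vwβ
      module S₁ = Colouring S₀.erase α v≢w (S₀.Free⁺ α-at-v) (S₀.Free⁺ (free-at-w (≢-sym α≢β) wX≢α wY≢α))
      module S₂ = Colouring S₁.colour β v≢u (S₁.Free⁺ (proj₁ β-freed) α≢β)
                                          (S₁.Free⁺ (S₀.Free⁺ (free-at-u (≡just⇒≢just ux′α α≢β))) α≢β)

    recolour-uw : X ≡ u → ecol φ₀ w X ≡ just α → PartialColouring (w ∷ u ∷ []) []
    recolour-uw X≡u wXα = S₂.colour
      where
      uw : Adj G u w
      uw = subst (λ t → Adj G t w) X≡u (Adj-sym G wX)
      uwα : ecol φ₀ u w ≡ just α
      uwα = subst (λ t → ecol φ₀ t w ≡ just α) X≡u (trans (ecol-sym φ₀ X w) wXα)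
      δ : Fin 9
      δ = ψ.ecol w Y
      wYδ : ecol φ₀ w Y ≡ just δ
      wYδ = ψ-colour (≢-sym v≢w) (≢-sym u≢w)
      fresh : ∃[ f ] f ∉ α ∷ β ∷ δ ∷ []
      fresh = missing-element (α ∷ β ∷ δ ∷ []) (s≤s (s≤s (s≤s (s≤s z≤n))))
      f : Fin 9
      f = proj₁ fresh
      α≢f : α ≢ f
      α≢f e = proj₂ fresh (here (sym e))
      β≢f : β ≢ f
      β≢f e = proj₂ fresh (there (here (sym e)))
      δ≢f : δ ≢ f
      δ≢f e = proj₂ fresh (there (there (here (sym e))))
      module S₀ = Erasure φ₀ ((u , w) ∷ [])
      α-freed : Free S₀.erase u α × Free S₀.erase w α
      α-freed = S₀.frees (here refl) uw uwα
      module S₁ = Colouring S₀.erase f u≢w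
        (S₀.Free⁺ (free-at-u (≡just⇒≢just ux′α α≢f)))
        (S₀.Free⁺ (free-at-w β≢f (≡just⇒≢just wXα α≢f) (≡just⇒≢just wYδ δ≢f)))
      module S₂ = Colouring S₁.colour α v≢u
        (S₁.Free⁺-apart (S₀.Free⁺ α-at-v) v≢u v≢w)
        (S₁.Free⁺ (proj₁ α-freed) (≢-sym α≢f))

    module Apex (X≢u : X ≢ u) (wXα : ecol φ₀ w X ≡ just α) where

      γ : Fin 9
      γ = ψ.ecol X v

      vXγ : ecol φ₀ v X ≡ just γ
      vXγ = trans (ecol-sym φ₀ v X) (ψ-colour (≢-sym v≢X) X≢u)

      α≢γ : α ≢ γ
      α≢γ = α-unused-at-v vX vXγ

      β≢γ : β ≢ γ
      β≢γ = colours-distinct φ₀ vw vX w≢X vwβ vXγ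

      swap-at-X : ecol φ₀ w Y ≢ just γ → PartialColouring (w ∷ u ∷ []) []
      swap-at-X wY≢γ = S₃.colour
        where
        module S₀ = Erasure φ₀ ((w , X) ∷ (v , X) ∷ [])
        α-freed : Free S₀.erase w α × Free S₀.erase X α
        α-freed = S₀.frees (here refl) wX wXα
        γ-freed : Free S₀.erase v γ × Free S₀.erase X γ
        γ-freed = S₀.frees (there (here refl)) vX vXγ
        module S₁ = Colouring S₀.erase γ w≢X
          (S₀.Free⁺ (free-at-w β≢γ (≡just⇒≢just wXα α≢γ) wY≢γ))
          (proj₂ γ-freed)
        module S₂ = Colouring S₁.colour α v≢X
          (S₁.Free⁺-apart (S₀.Free⁺ α-at-v) v≢w v≢X)
          (S₁.Free⁺ (proj₂ α-freed) (≢-sym α≢γ))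
        module S₃ = Colouring S₂.colour γ v≢u
          (S₂.Free⁺ (S₁.Free⁺-apart (proj₁ γ-freed) v≢w v≢X) α≢γ)
          (S₂.Free⁺ (S₁.Free⁺-apart (S₀.Free⁺ (free-at-u (≡just⇒≢just ux′α α≢γ))) u≢w (≢-sym X≢u)) α≢γ)

      module Rotation (wYγ : ecol φ₀ w Y ≡ just γ) where

        Y≢u : Y ≢ u
        Y≢u Y≡u = α≢γ (just-injective (trans (sym wuα) wuγ))
          where
          wu : Adj G w u
          wu = subst (Adj G w) Y≡u wY
          wuγ : ecol φ₀ w u ≡ just γ
          wuγ = subst (λ t → ecol φ₀ w t ≡ just γ) Y≡u wYγ
          wuα : ecol φ₀ w u ≡ just α
          wuα with around-u (Adj-sym G wu)
          ... | here w≡v          = contradiction (sym w≡v) v≢w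
          ... | there (here w≡x′) = trans (ecol-sym φ₀ w u) (subst (λ t → ecol φ₀ u t ≡ just α) (sym w≡x′) ux′α)

        ε : Fin 9
        ε = ψ.ecol Y v

        vYε : ecol φ₀ v Y ≡ just ε
        vYε = trans (ecol-sym φ₀ v Y) (ψ-colour (≢-sym v≢Y) Y≢u)

        α≢ε : α ≢ ε
        α≢ε = α-unused-at-v vY vYε

        β≢ε : β ≢ ε
        β≢ε = colours-distinct φ₀ vw vY w≢Y vwβ vYε

        γ≢ε : γ ≢ ε
        γ≢ε = colours-distinct φ₀ vX vY X≢Y vXγ vYε

        rotate-around-vXwY : PartialColouring (w ∷ u ∷ []) []
        rotate-around-vXwY = S₅.colour
          where
          module S₀ = Erasure φ₀ ((w , Y) ∷ (v , Y) ∷ (w , X) ∷ (v , X) ∷ [])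
          γ-freed-wY : Free S₀.erase w γ × Free S₀.erase Y γ
          γ-freed-wY = S₀.frees (here refl) wY wYγ
          ε-freed : Free S₀.erase v ε × Free S₀.erase Y ε
          ε-freed = S₀.frees (there (here refl)) vY vYε
          α-freed : Free S₀.erase w α × Free S₀.erase X α
          α-freed = S₀.frees (there (there (here refl))) wX wXα
          γ-freed-vX : Free S₀.erase v γ × Free S₀.erase X γ
          γ-freed-vX = S₀.frees (there (there (there (here refl)))) vX vXγ
          module S₁ = Colouring S₀.erase ε w≢Y
            (S₀.Free⁺ (free-at-w β≢ε (≡just⇒≢just wXα α≢ε) (≡just⇒≢just wYγ γ≢ε)))
            (proj₂ ε-freed)
          module S₂ = Colouring S₁.colour γ v≢Y
            (S₁.Free⁺ (proj₁ γ-freed-vX) (≢-sym γ≢ε))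
            (S₁.Free⁺ (proj₂ γ-freed-wY) (≢-sym γ≢ε))
          module S₃ = Colouring S₂.colour γ w≢X
            (S₂.Free⁺-apart (S₁.Free⁺ (proj₁ γ-freed-wY) (≢-sym γ≢ε)) (≢-sym v≢w) w≢Y)
            (S₂.Free⁺-apart (S₁.Free⁺ (proj₂ γ-freed-vX) (≢-sym γ≢ε)) (≢-sym v≢X) X≢Y)
          module S₄ = Colouring S₃.colour α v≢X
            (S₃.Free⁺ (S₂.Free⁺ (S₁.Free⁺ (S₀.Free⁺ α-at-v) (≢-sym α≢ε)) (≢-sym α≢γ)) (≢-sym α≢γ))
            (S₃.Free⁺ (S₂.Free⁺ (S₁.Free⁺ (proj₂ α-freed) (≢-sym α≢ε)) (≢-sym α≢γ)) (≢-sym α≢γ))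
          module S₅ = Colouring S₄.colour ε v≢u
            (S₄.Free⁺ (S₃.Free⁺ (S₂.Free⁺ (S₁.Free⁺-apart (proj₁ ε-freed) v≢w v≢Y) γ≢ε) γ≢ε) α≢ε)
            (S₄.Free⁺ (S₃.Free⁺ (S₂.Free⁺ (S₁.Free⁺-apart (S₀.Free⁺ (free-at-u (≡just⇒≢just ux′α α≢ε)))
                                                           u≢w (≢-sym Y≢u)) γ≢ε) γ≢ε) α≢ε)

    recolour-at-X : ecol φ₀ w X ≡ just α → PartialColouring (w ∷ u ∷ []) []
    recolour-at-X wXα = by-apex (X ≟ u)
      where
      by-apex : Dec (X ≡ u) → PartialColouring (w ∷ u ∷ []) []
      by-apex (yes X≡u) = recolour-uw X≡u wXα
      by-apex (no X≢u) with ≡-dec _≟_ (ecol φ₀ w Y) (just (Apex.γ X≢u wXα))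
      ... | yes wYγ = Apex.Rotation.rotate-around-vXwY X≢u wXα wYγ
      ... | no wY≢γ = Apex.swap-at-X X≢u wXα wY≢γ

  recolouring : ∀ {X Y} → Adj G v X → Adj G w X → Adj G v Y → Adj G w Y → X ≢ Y →
                (∀ {a} → Adj G w a → a ∈ v ∷ X ∷ Y ∷ []) → PartialColouring (w ∷ u ∷ []) []
  recolouring {X} {Y} vX wX vY wY X≢Y around-w with ≡-dec _≟_ (ecol φ₀ u x′) (just α)
  ... | no ux′≢α = recolour-vu ux′≢α
  ... | yes ux′α with ≡-dec _≟_ (ecol φ₀ w X) (just α) | ≡-dec _≟_ (ecol φ₀ w Y) (just α)
  ...   | yes wXα | _       = Triangle.recolour-at-X vX wX vY wY X≢Y around-w ux′α wXα
  ...   | no _    | yes wYα = Triangle.recolour-at-X vY wY vX wX (≢-sym X≢Y) (swap ∘ around-w) ux′α wYα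
    where
    swap : ∀ {a} → a ∈ v ∷ X ∷ Y ∷ [] → a ∈ v ∷ Y ∷ X ∷ []
    swap (here a≡v)                = here a≡v
    swap (there (here a≡X))        = there (there (here a≡X))
    swap (there (there (here a≡Y))) = there (here a≡Y)
  ...   | no wX≢α | no wY≢α = Triangle.recolour-vw vX wX vY wY X≢Y around-w ux′α wX≢α wY≢α

  extension : PartialColouring (w ∷ u ∷ []) [] → TotalColoring 9 G
  extension φ = complete zero (colourVertex φ′ (proj₁ u-free) (proj₂ u-free))
    where
    w-free : ∃[ c ] VertexFree φ w c
    w-free = free-vertex-colour φ (s≤s (+-mono-≤ deg-w deg-w))
    φ′ : PartialColouring (u ∷ []) []
    φ′ = colourVertex φ (proj₁ w-free) (proj₂ w-free)
    u-free : ∃[ c ] VertexFree φ′ u c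
    u-free = free-vertex-colour φ′ (s≤s (+-mono-≤ deg-u deg-u))

lemma2p7 : ∀ {n} (G : Graph n) (R : RotationSystem G) → IsPlaneEmbedding G R
    → MinimalCounterexample G
    → ∀ v w → deg G v ≡ 8 → Adj G v w → deg G w ≡ 3 → OnTwo3Faces R v w
    → ∀ u → Adj G v u → deg G u ≢ 2
lemma2p7 {n} G R _ MC v w deg-v vw deg-w (face-vw , face-wv , _) u vu deg-u =
  noColoring (extension (recolouring vX wX vY wY X≢Y around-w))
  where
  open MinimalCounterexample MC using (noColoring; delEdge)
  X Y : Fin n
  X = rot R w v
  Y = rot R v w
  vX : Adj G v X
  vX = proj₁ (apex-adjacent R face-vw vw)
  wX : Adj G w X
  wX = proj₂ (apex-adjacent R face-vw vw)
  wY : Adj G w Y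
  wY = proj₁ (apex-adjacent R face-wv (Adj-sym G vw))
  vY : Adj G v Y
  vY = proj₂ (apex-adjacent R face-wv (Adj-sym G vw))
  X≢Y : X ≢ Y
  X≢Y = apexes-distinct R face-wv vw (subst (2 <_) (sym deg-w) ≤-refl)
  around-w : ∀ {a} → Adj G w a → a ∈ v ∷ X ∷ Y ∷ []
  around-w = neighbours-within G ((Adj-irrefl G vX ∷ Adj-irrefl G vY ∷ []) ∷ (X≢Y ∷ []) ∷ [] ∷ [])
                                 (Adj-sym G vw ∷ wX ∷ wY ∷ []) (sym deg-w)
  u≢w : u ≢ w
  u≢w u≡w = contradiction (trans (sym deg-u) (trans (cong (deg G) u≡w) deg-w)) λ ()
  open Reducible (delEdge v u vu) vu vw u≢w (≤-reflexive deg-v) (≤-trans (≤-reflexive deg-w) (s≤s (s≤s (s≤s z≤n))))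
                 (≤-trans (≤-reflexive deg-u) (s≤s (s≤s z≤n))) (proj₂ (neighbours-of-degree-two G deg-u (Adj-sym G vu)))
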